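{- Let $n,d\ge1$ be integers and let $i\in\{0,1,\dots,nd\}$ with $i\not\equiv0\pmod d$. Then $$H_i+H_{nd-i-d}=\frac{(d-1)^n-(-1)^n}{d}.$$
   Context: For $j\in\mathbb Z$ let $h_j=\#\{u\in\{1,\dots,d-1\}^n : u_1+\cdots+u_n=j\}$ (so $h_j=0$ unless $0\le j\le nd$). For an integer $m\le nd$, the arithmetic Hodge sum is $H_m=\sum_{t\ge0}h_{m-td}$ (so $H_m=0$ when $m<0$). -}

module Defs where

open import Data.Nat using (ℕ; zero; suc; _*_; _∸_; _≤?_; _≟_)
open import Data.List using (List; []; _∷_; map; concatMap; filter; length; upTo; applyUpTo)
open import Data.Nat.ListAction using (sum)
open import Data.Vec using (Vec; []; _∷_)
import Data.Vec as V
open import Data.Integer using (ℤ; +_; -[1+_])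

allVecs : (n d : ℕ) → List (Vec ℕ n)
allVecs zero    d = [] ∷ []
allVecs (suc n) d =
  concatMap (λ a → map (a ∷_) (allVecs n d)) (applyUpTo suc (d ∸ 1))

hN : (n d j : ℕ) → ℕ
hN n d j = length (filter (λ u → V.sum u ≟ j) (allVecs n d))

h : (n d : ℕ) → ℤ → ℕ
h n d (+ j)    = hN n d j
h n d -[1+ _ ] = 0

-- H_m = Σ_{t ≥ 0} h_{m - t d} for m ∈ ℕ: only terms with t*d ≤ m contribute
-- (h vanishes at negative indices); all such t lie in 0..m when d ≥ 1.
HN : (n d m : ℕ) → ℕ
HN n d m = sum (map (λ t → hN n d (m ∸ t * d))
                    (filter (λ t → t * d ≤? m) (upTo (suc m))))

H : (n d : ℕ) → ℤ → ℕ
H n d (+ m)    = HN n d m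
H n d -[1+ _ ] = 0

module Submission where

-- Write d = e + 1 and, for a bound B, let H^B_n(m) = Σ_{t<B} h_n(m - t d) be the
-- Hodge sum truncated to its first B terms; once B exceeds |m| it equals H_m.
-- The proof is an induction on n driven by two recursions:
--   * h_{n+1}(j) = Σ_{a=1}^{e} h_n(j - a)   (split a vector by its first entry),
--     hence H^B_{n+1}(m) = Σ_{a=1}^{e} H^B_n(m - a);
--   * the reflected pair K_n(i) = H^B_n(i) + H^B_n(nd - i - d) obeys the same
--     recursion, after reversing the order of summation in the second half.
-- For the window sums W_n(i) = Σ_{a=0}^{e} K_n(i - a) this gives W_{n+1}(i) =
-- Σ_{b=1}^{e} W_n(i - b), while W_0 ≡ 1 because every integer is hit exactly
-- once by i - a - t d (0 ≤ a ≤ e) or by its reflection -i - 1 - a - t d.  Hence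
-- W_n ≡ e^n, i.e. K_{n+1}(i) + K_n(i) = e^n, and since K_0(i) = 0 when d ∤ i an
-- induction gives d K_n(i) = e^n - (-1)^n, which is the theorem.

open import Defs
open import Data.Nat using (ℕ; _≤_; _∸_)
open import Data.Nat.Divisibility using (_∣_)
open import Data.Integer using (ℤ; +_; -_; _-_; _^_) renaming (_*_ to _*ℤ_; _+_ to _+ℤ_)
import Data.Nat as N
open import Relation.Nullary using (¬_)
open import Relation.Binary.PropositionalEquality using (_≡_)

open import Data.Nat using (zero; suc; _+_; _*_; _<_; _≟_; _<?_; _≤?_; _≤′_; ≤′-refl; ≤′-step; s≤s)
import Data.Nat.Properties as NP
open import Data.Nat.Divisibility using (divides)
open import Data.Integer using (-[1+_]; ∣_∣)
import Data.Integer.Properties as ZP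
open import Data.Integer.Tactic.RingSolver using (solve-∀)
open import Algebra.Properties.CommutativeSemigroup NP.+-commutativeSemigroup
  using (interchange; xy∙z≈xz∙y)
open import Data.List using (List; []; _∷_; _++_; map; concatMap; filter; length; applyUpTo)
import Data.List.Properties as LP
open import Data.Nat.ListAction using (sum)
import Data.List.Relation.Unary.All as All
open import Data.Vec using (_∷_)
import Data.Vec as V
open import Relation.Nullary using (Dec; yes; no; contradiction)
open import Relation.Unary using (Pred; Decidable)
open import Relation.Binary.Definitions using (tri<; tri≈; tri>)
open import Data.Product using (_,_)
open import Relation.Binary.PropositionalEquality
  using (_≢_; refl; sym; trans; cong; cong₂; module ≡-Reasoning)

open ≡-Reasoning

Σ< : ℕ → (ℕ → ℕ) → ℕ
Σ< zero    f = 0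
Σ< (suc n) f = Σ< n f + f n

Σ-cong : ∀ n {f g : ℕ → ℕ} → (∀ a → a < n → f a ≡ g a) → Σ< n f ≡ Σ< n g
Σ-cong zero    f≡g = refl
Σ-cong (suc n) f≡g =
  cong₂ _+_ (Σ-cong n (λ a a<n → f≡g a (NP.m<n⇒m<1+n a<n))) (f≡g n NP.≤-refl)

Σ-vanish : ∀ n {f : ℕ → ℕ} → (∀ a → f a ≡ 0) → Σ< n f ≡ 0
Σ-vanish zero    f≡0 = refl
Σ-vanish (suc n) f≡0 = cong₂ _+_ (Σ-vanish n f≡0) (f≡0 n)

Σ-const : ∀ n c → Σ< n (λ _ → c) ≡ n * c
Σ-const zero    c = refl
Σ-const (suc n) c = trans (cong (_+ c) (Σ-const n c)) (NP.+-comm (n * c) c)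

Σ-+ : ∀ n (f g : ℕ → ℕ) → Σ< n (λ a → f a + g a) ≡ Σ< n f + Σ< n g
Σ-+ zero    f g = refl
Σ-+ (suc n) f g =
  trans (cong (_+ (f n + g n)) (Σ-+ n f g)) (interchange (Σ< n f) (Σ< n g) (f n) (g n))

Σ-swap : ∀ m n (F : ℕ → ℕ → ℕ) →
         Σ< m (λ a → Σ< n (F a)) ≡ Σ< n (λ t → Σ< m (λ a → F a t))
Σ-swap zero    n F = sym (Σ-vanish n (λ _ → refl))
Σ-swap (suc m) n F =
  trans (cong (_+ Σ< n (F m)) (Σ-swap m n F)) (sym (Σ-+ n (λ t → Σ< m (λ a → F a t)) (F m)))

Σ-front : ∀ n (f : ℕ → ℕ) → Σ< (suc n) f ≡ f 0 + Σ< n (λ a → f (suc a))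
Σ-front zero    f = NP.+-comm 0 (f 0)
Σ-front (suc n) f =
  trans (cong (_+ f (suc n)) (Σ-front n f)) (NP.+-assoc (f 0) _ (f (suc n)))

Σ-rev : ∀ n (f : ℕ → ℕ) → Σ< n f ≡ Σ< n (λ a → f (n ∸ suc a))
Σ-rev zero    f = refl
Σ-rev (suc n) f = begin
  Σ< n f + f n                        ≡⟨ NP.+-comm (Σ< n f) (f n) ⟩
  f n + Σ< n f                        ≡⟨ cong (f n N.+_) (Σ-rev n f) ⟩
  f n + Σ< n (λ a → f (n ∸ suc a))   ≡⟨ sym (Σ-front n (λ a → f (suc n ∸ suc a))) ⟩
  Σ< (suc n) (λ a → f (suc n ∸ suc a)) ∎

Σ-truncate : ∀ {N B} (f : ℕ → ℕ) → N ≤ B → (∀ t → N ≤ t → f t ≡ 0) → Σ< B f ≡ Σ< N f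
Σ-truncate {N} f N≤B tail≡0 = go (NP.≤⇒≤′ N≤B)
  where
  go : ∀ {B} → N ≤′ B → Σ< B f ≡ Σ< N f
  go ≤′-refl            = refl
  go (≤′-step {B} N≤′B) = begin
    Σ< B f + f B ≡⟨ cong (Σ< B f N.+_) (tail≡0 B (NP.≤′⇒≤ N≤′B)) ⟩
    Σ< B f + 0   ≡⟨ NP.+-identityʳ (Σ< B f) ⟩
    Σ< B f       ≡⟨ go N≤′B ⟩
    Σ< N f       ∎

telescope : ∀ B (g u : ℕ → ℕ) → (∀ t → g t + u t ≡ u (suc t)) → Σ< B g + u 0 ≡ u B
telescope zero    g u step = refl
telescope (suc B) g u step = begin
  Σ< B g + g B + u 0   ≡⟨ xy∙z≈xz∙y (Σ< B g) (g B) (u 0) ⟩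
  Σ< B g + u 0 + g B   ≡⟨ cong (_+ g B) (telescope B g u step) ⟩
  u B + g B            ≡⟨ NP.+-comm (u B) (g B) ⟩
  g B + u B            ≡⟨ step B ⟩
  u (suc B)            ∎

ind : ∀ {p} {P : Set p} → Dec P → ℕ
ind (yes _) = 1
ind (no _)  = 0

ind-yes : ∀ {p} {P : Set p} (P? : Dec P) → P → ind P? ≡ 1
ind-yes (yes _) _ = refl
ind-yes (no ¬p) p = contradiction p ¬p

ind-no : ∀ {p} {P : Set p} (P? : Dec P) → ¬ P → ind P? ≡ 0
ind-no (yes p) ¬p = contradiction p ¬p
ind-no (no _)  _  = refl

ind-<-suc : ∀ k c → ind (k ≟ c) + ind (k <? c) ≡ ind (k <? suc c)
ind-<-suc k c with NP.<-cmp k c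
... | tri< k<c _ _
  rewrite ind-no (k ≟ c) (NP.<⇒≢ k<c) | ind-yes (k <? c) k<c
        | ind-yes (k <? suc c) (NP.m<n⇒m<1+n k<c) = refl
... | tri≈ _ refl _
  rewrite ind-yes (k ≟ k) refl | ind-no (k <? k) (NP.<-irrefl refl)
        | ind-yes (k <? suc k) NP.≤-refl = refl
... | tri> _ _ c<k
  rewrite ind-no (k ≟ c) (NP.>⇒≢ c<k) | ind-no (k <? c) (NP.<⇒≯ c<k)
        | ind-no (k <? suc c) (NP.≤⇒≯ c<k) = refl

when : ∀ {p} {P : Set p} → Dec P → ℕ → ℕ
when (yes _) x = x
when (no _)  x = 0

count : ∀ {a p} {A : Set a} {P : Pred A p} → Decidable P → List A → ℕ
count P? xs = length (filter P? xs)

count-map : ∀ {a b p} {A : Set a} {B : Set b} {P : Pred B p} (P? : Decidable P) (f : A → B) xs →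
            count P? (map f xs) ≡ count (λ x → P? (f x)) xs
count-map P? f []       = refl
count-map P? f (x ∷ xs) with P? (f x)
... | yes _ = cong suc (count-map P? f xs)
... | no _  = count-map P? f xs

count-concatMap : ∀ {a b p} {A : Set a} {B : Set b} {P : Pred B p} (P? : Decidable P)
                  (F : A → List B) (g : ℕ → A) n →
                  count P? (concatMap F (applyUpTo g n)) ≡ Σ< n (λ a → count P? (F (g a)))
count-concatMap P? F g zero    = refl
count-concatMap P? F g (suc n) = begin
  length (filter P? (F (g 0) ++ rest))
    ≡⟨ cong length (LP.filter-++ P? (F (g 0)) rest) ⟩
  length (filter P? (F (g 0)) ++ filter P? rest)
    ≡⟨ LP.length-++ (filter P? (F (g 0))) ⟩
  count P? (F (g 0)) + count P? rest
    ≡⟨ cong (count P? (F (g 0)) N.+_) (count-concatMap P? F (λ a → g (suc a)) n) ⟩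
  count P? (F (g 0)) + Σ< n (λ a → count P? (F (g (suc a))))
    ≡⟨ sym (Σ-front n (λ a → count P? (F (g a)))) ⟩
  Σ< (suc n) (λ a → count P? (F (g a))) ∎
  where
  rest = concatMap F (applyUpTo (λ a → g (suc a)) n)

sum-filter : ∀ {p} {P : Pred ℕ p} (P? : Decidable P) (g f : ℕ → ℕ) n →
             sum (map g (filter P? (applyUpTo f n))) ≡ Σ< n (λ a → when (P? (f a)) (g (f a)))
sum-filter P? g f zero    = refl
sum-filter P? g f (suc n) =
  trans head (sym (Σ-front n (λ a → when (P? (f a)) (g (f a)))))
  where
  head : sum (map g (filter P? (applyUpTo f (suc n))))
       ≡ when (P? (f 0)) (g (f 0)) + Σ< n (λ a → when (P? (f (suc a))) (g (f (suc a))))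
  head with P? (f 0)
  ... | yes _ = cong (g (f 0) N.+_) (sum-filter P? g (λ a → f (suc a)) n)
  ... | no _  = sum-filter P? g (λ a → f (suc a)) n

sub-≥ : ∀ {k c} → c ≤ k → + k - + c ≡ + (k ∸ c)
sub-≥ {k} {c} c≤k = trans (ZP.[+m]-[+n]≡m⊖n k c) (ZP.⊖-≥ c≤k)

sub-< : ∀ {k c} → k < c → + k - + c ≡ -[1+ (c ∸ suc k) ]
sub-< {k} {c} k<c =
  trans (ZP.[+m]-[+n]≡m⊖n k c) (trans (ZP.⊖-< k<c) (cong (λ x → - + x) (NP.+-∸-assoc 1 k<c)))

neg-pred : ∀ k → - (+ k) - + 1 ≡ -[1+ k ]
neg-pred zero    = refl
neg-pred (suc k) = ZP.neg-minus-pos k 1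

pos-^ : ∀ m n → + (m N.^ n) ≡ (+ m) ^ n
pos-^ m zero    = refl
pos-^ m (suc n) = trans (ZP.pos-* m (m N.^ n)) (cong (+ m *ℤ_) (pos-^ m n))

sub-swap : ∀ (x y z : ℤ) → x - y - z ≡ x - z - y
sub-swap = solve-∀

h-sub : ∀ n d k c → h n d (+ k - + c) ≡ when (c ≤? k) (hN n d (k ∸ c))
h-sub n d k c with c ≤? k
... | yes c≤k = cong (h n d) (sub-≥ c≤k)
... | no  c≰k = cong (h n d) (sub-< (NP.≰⇒> c≰k))

h-shift : ∀ n d k c → count (λ u → c + V.sum u ≟ k) (allVecs n d) ≡ h n d (+ k - + c)
h-shift n d k c = trans shifted (sym (h-sub n d k c))
  where
  shifted : count (λ u → c + V.sum u ≟ k) (allVecs n d) ≡ when (c ≤? k) (hN n d (k ∸ c))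
  shifted with c ≤? k
  ... | yes c≤k = cong length (LP.filter-≐ (λ u → c + V.sum u ≟ k) (λ u → V.sum u ≟ k ∸ c)
         ((λ {u} eq → trans (sym (NP.m+n∸m≡n c (V.sum u))) (cong (_∸ c) eq)) ,
          (λ eq → trans (cong (c N.+_) eq) (NP.m+[n∸m]≡n c≤k)))
         (allVecs n d))
  ... | no  c≰k = cong length (LP.filter-none (λ u → c + V.sum u ≟ k)
         (All.universal (λ u eq → c≰k (NP.≤-trans (NP.m≤m+n c (V.sum u)) (NP.≤-reflexive eq)))
                        (allVecs n d)))

-- First-entry decomposition: h_{n+1}(j) = Σ_{a=1}^{d-1} h_n(j - a).
h-rec : ∀ n d j → h (suc n) d j ≡ Σ< (d ∸ 1) (λ a → h n d (j - + suc a))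
h-rec n d (+ k) = begin
  hN (suc n) d k
    ≡⟨ count-concatMap (λ u → V.sum u ≟ k) (λ a → map (a ∷_) (allVecs n d)) suc (d ∸ 1) ⟩
  Σ< (d ∸ 1) (λ a → count (λ u → V.sum u ≟ k) (map (suc a ∷_) (allVecs n d)))
    ≡⟨ Σ-cong (d ∸ 1) (λ a _ → count-map (λ u → V.sum u ≟ k) (suc a ∷_) (allVecs n d)) ⟩
  Σ< (d ∸ 1) (λ a → count (λ u → suc a + V.sum u ≟ k) (allVecs n d))
    ≡⟨ Σ-cong (d ∸ 1) (λ a _ → h-shift n d k (suc a)) ⟩
  Σ< (d ∸ 1) (λ a → h n d (+ k - + suc a)) ∎
h-rec n d -[1+ k ] = sym (Σ-vanish (d ∸ 1) (λ a → cong (h n d) (ZP.neg-minus-pos k (suc a))))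

h₀-off : ∀ d j → j ≢ + 0 → h 0 d j ≡ 0
h₀-off d (+ zero)  j≢0 = contradiction refl j≢0
h₀-off d (+ suc j) j≢0 = refl
h₀-off d -[1+ j ]  j≢0 = refl

h₀-at : ∀ d k c → h 0 d (+ k - + c) ≡ ind (k ≟ c)
h₀-at d k c with k ≟ c
... | yes refl = cong (h 0 d) (trans (sub-≥ {k} NP.≤-refl) (cong +_ (NP.n∸n≡0 k)))
... | no  k≢c  = h₀-off d (+ k - + c) (λ eq → k≢c (ZP.+-injective (ZP.i-j≡0⇒i≡j (+ k) (+ c) eq)))

HB : (n d B : ℕ) → ℤ → ℕ
HB n d B m = Σ< B (λ t → h n d (m - + (t * d)))

HB-neg : ∀ n d B k → HB n d B -[1+ k ] ≡ 0
HB-neg n d B k = Σ-vanish B (λ t → cong (h n d) (ZP.neg-minus-pos k (t * d)))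

-- For B > |m| the truncation loses nothing (d ≥ 1 makes later terms vanish).
H-trunc : ∀ n e B m → ∣ m ∣ < B → H n (suc e) m ≡ HB n (suc e) B m
H-trunc n e B -[1+ k ] _   = sym (HB-neg n (suc e) B k)
H-trunc n e B (+ m)    m<B = begin
  HN n d m
    ≡⟨ sum-filter (λ t → t * d ≤? m) (λ t → hN n d (m ∸ t * d)) (λ t → t) (suc m) ⟩
  Σ< (suc m) (λ t → when (t * d ≤? m) (hN n d (m ∸ t * d)))
    ≡⟨ Σ-cong (suc m) (λ t _ → sym (h-sub n d m (t * d))) ⟩
  Σ< (suc m) (λ t → h n d (+ m - + (t * d)))
    ≡⟨ sym (Σ-truncate (λ t → h n d (+ m - + (t * d))) m<B beyond) ⟩
  HB n d B (+ m) ∎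
  where
  d = suc e
  beyond : ∀ t → suc m ≤ t → h n d (+ m - + (t * d)) ≡ 0
  beyond t m<t = cong (h n d) (sub-< (NP.<-≤-trans m<t (NP.m≤m*n t d)))

HB-rec : ∀ n d B m → HB (suc n) d B m ≡ Σ< (d ∸ 1) (λ a → HB n d B (m - + suc a))
HB-rec n d B m = begin
  Σ< B (λ t → h (suc n) d (m - + (t * d)))
    ≡⟨ Σ-cong B (λ t _ → h-rec n d (m - + (t * d))) ⟩
  Σ< B (λ t → Σ< (d ∸ 1) (λ a → h n d (m - + (t * d) - + suc a)))
    ≡⟨ sym (Σ-swap (d ∸ 1) B (λ a t → h n d (m - + (t * d) - + suc a))) ⟩
  Σ< (d ∸ 1) (λ a → Σ< B (λ t → h n d (m - + (t * d) - + suc a)))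
    ≡⟨ Σ-cong (d ∸ 1) (λ a _ → Σ-cong B (λ t _ → cong (h n d) (sub-swap m _ _))) ⟩
  Σ< (d ∸ 1) (λ a → HB n d B (m - + suc a)) ∎

-- One full period of H_0: each 0 ≤ k < B d is a + t d for exactly one a < d, t < B.
H₀-window : ∀ e B k → k < B → Σ< (suc e) (λ a → HB 0 (suc e) B (+ k - + a)) ≡ 1
H₀-window e B k k<B = begin
  Σ< d (λ a → Σ< B (λ t → h 0 d (+ k - + a - + (t * d))))
    ≡⟨ Σ-cong d (λ a _ → Σ-cong B (λ t _ → h₀-shifted a (t * d))) ⟩
  Σ< d (λ a → Σ< B (λ t → ind (k ≟ a + t * d)))
    ≡⟨ Σ-swap d B (λ a t → ind (k ≟ a + t * d)) ⟩
  Σ< B (λ t → Σ< d (λ a → ind (k ≟ a + t * d)))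
    ≡⟨ sym (NP.+-identityʳ _) ⟩
  Σ< B (λ t → Σ< d (λ a → ind (k ≟ a + t * d))) + ind (k <? 0 * d)
    ≡⟨ telescope B _ (λ t → ind (k <? t * d)) period ⟩
  ind (k <? B * d)
    ≡⟨ ind-yes (k <? B * d) (NP.<-≤-trans k<B (NP.m≤m*n B d)) ⟩
  1 ∎
  where
  d = suc e
  h₀-shifted : ∀ a c → h 0 d (+ k - + a - + c) ≡ ind (k ≟ a + c)
  h₀-shifted a c = begin
    h 0 d (+ k - + a - + c)    ≡⟨ cong (h 0 d) (sub-sub (+ k) (+ a) (+ c)) ⟩
    h 0 d (+ k - (+ a +ℤ + c)) ≡⟨ cong (λ x → h 0 d (+ k - x)) (sym (ZP.pos-+ a c)) ⟩
    h 0 d (+ k - + (a + c))    ≡⟨ h₀-at d k (a + c) ⟩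
    ind (k ≟ a + c)            ∎
    where
    sub-sub : ∀ (x y z : ℤ) → x - y - z ≡ x - (y +ℤ z)
    sub-sub = solve-∀
  period : ∀ t → Σ< d (λ a → ind (k ≟ a + t * d)) + ind (k <? t * d) ≡ ind (k <? suc t * d)
  period t = telescope d (λ a → ind (k ≟ a + t * d)) (λ a → ind (k <? a + t * d))
                         (λ a → ind-<-suc k (a + t * d))

H₀-window-neg : ∀ m d B k → Σ< m (λ a → HB 0 d B (-[1+ k ] - + a)) ≡ 0
H₀-window-neg m d B k =
  Σ-vanish m (λ a → trans (cong (HB 0 d B) (ZP.neg-minus-pos k a)) (HB-neg 0 d B (a + k)))

reflect : ℕ → ℕ → ℤ → ℤ
reflect n e i = + (n * suc e) - i - + suc e

K : (n e B : ℕ) → ℤ → ℕ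
K n e B i = HB n (suc e) B i + HB n (suc e) B (reflect n e i)

-- Reversing a ↦ e - 1 - a turns the reflected index at n+1 into that at n.
reflect-shift : ∀ n e i a → a < e →
                reflect (suc n) e i - + suc (e ∸ suc a) ≡ reflect n e (i - + suc a)
reflect-shift n e i a a<e = begin
  + (suc e + n * suc e) - i - + suc e - + suc (e ∸ suc a)
    ≡⟨ cong₂ (λ x y → x - i - + suc e - + y) (ZP.pos-+ (suc e) (n * suc e))
             (sym (NP.+-∸-assoc 1 a<e)) ⟩
  (+ suc e +ℤ + (n * suc e)) - i - + suc e - + (suc e ∸ suc a)
    ≡⟨ cong (λ x → (+ suc e +ℤ + (n * suc e)) - i - + suc e - x) (sym (sub-≥ (s≤s (NP.<⇒≤ a<e)))) ⟩
  (+ suc e +ℤ + (n * suc e)) - i - + suc e - (+ suc e - + suc a)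
    ≡⟨ reassociate (+ (n * suc e)) i (+ suc e) (+ suc a) ⟩
  + (n * suc e) - (i - + suc a) - + suc e ∎
  where
  reassociate : ∀ (X I D S : ℤ) → (D +ℤ X) - I - D - (D - S) ≡ X - (I - S) - D
  reassociate = solve-∀

K-rec : ∀ n e B i → K (suc n) e B i ≡ Σ< e (λ a → K n e B (i - + suc a))
K-rec n e B i = begin
  HB (suc n) d B i + HB (suc n) d B (reflect (suc n) e i)
    ≡⟨ cong₂ _+_ (HB-rec n d B i) (HB-rec n d B (reflect (suc n) e i)) ⟩
  Σ< e (λ a → HB n d B (i - + suc a)) + Σ< e (λ a → HB n d B (reflect (suc n) e i - + suc a))
    ≡⟨ cong (Σ< e (λ a → HB n d B (i - + suc a)) N.+_) (Σ-rev e _) ⟩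
  Σ< e (λ a → HB n d B (i - + suc a))
    + Σ< e (λ a → HB n d B (reflect (suc n) e i - + suc (e ∸ suc a)))
    ≡⟨ cong (Σ< e (λ a → HB n d B (i - + suc a)) N.+_)
            (Σ-cong e (λ a a<e → cong (HB n d B) (reflect-shift n e i a a<e))) ⟩
  Σ< e (λ a → HB n d B (i - + suc a)) + Σ< e (λ a → HB n d B (reflect n e (i - + suc a)))
    ≡⟨ sym (Σ-+ e _ _) ⟩
  Σ< e (λ a → K n e B (i - + suc a)) ∎
  where
  d = suc e

reflect₀ : ∀ e j → reflect 0 e j ≡ (- j - + 1) - + e
reflect₀ e j = begin
  + 0 - j - + suc e          ≡⟨ cong (λ x → + 0 - j - x) (ZP.pos-+ 1 e) ⟩
  + 0 - j - (+ 1 +ℤ + e)     ≡⟨ regroup j (+ e) ⟩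
  (- j - + 1) - + e          ∎
  where
  regroup : ∀ (j E : ℤ) → + 0 - j - (+ 1 +ℤ E) ≡ (- j - + 1) - E
  regroup = solve-∀

-- K_0(i) = 0 when d ∤ i: i is no multiple of d and -i - d is negative.
K₀-vanish : ∀ e B i → ¬ (suc e ∣ i) → K 0 e B (+ i) ≡ 0
K₀-vanish e B i d∤i = cong₂ _+_ direct reflected
  where
  d = suc e
  direct : HB 0 d B (+ i) ≡ 0
  direct = Σ-vanish B (λ t → h₀-off d (+ i - + (t * d))
    (λ eq → d∤i (divides t (ZP.+-injective (ZP.i-j≡0⇒i≡j (+ i) (+ (t * d)) eq)))))
  reflected : HB 0 d B (reflect 0 e (+ i)) ≡ 0
  reflected = begin
    HB 0 d B (reflect 0 e (+ i))     ≡⟨ cong (HB 0 d B) (reflect₀ e (+ i)) ⟩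
    HB 0 d B (- (+ i) - + 1 - + e)   ≡⟨ cong (λ x → HB 0 d B (x - + e)) (neg-pred i) ⟩
    HB 0 d B (-[1+ i ] - + e)        ≡⟨ cong (HB 0 d B) (ZP.neg-minus-pos i e) ⟩
    HB 0 d B -[1+ (e + i) ]          ≡⟨ HB-neg 0 d B (e + i) ⟩
    0                                ∎

W : (n e B : ℕ) → ℤ → ℕ
W n e B i = Σ< (suc e) (λ a → K n e B (i - + a))

-- Exactly one of i, -i-1 is a natural number, and its period contributes 1.
W₀ : ∀ e B i → ∣ i ∣ < B → W 0 e B i ≡ 1
W₀ e B i |i|<B = begin
  Σ< d (λ a → HB 0 d B (i - + a) + HB 0 d B (reflect 0 e (i - + a)))
    ≡⟨ Σ-+ d _ _ ⟩
  V i + Σ< d (λ a → HB 0 d B (reflect 0 e (i - + a)))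
    ≡⟨ cong (V i N.+_) (Σ-rev d _) ⟩
  V i + Σ< d (λ a → HB 0 d B (reflect 0 e (i - + (e ∸ a))))
    ≡⟨ cong (V i N.+_) (Σ-cong d (λ a a<d → cong (HB 0 d B) (mirror a (NP.≤-pred a<d)))) ⟩
  V i + V (- i - + 1)
    ≡⟨ one-side i |i|<B ⟩
  1 ∎
  where
  d = suc e
  V : ℤ → ℕ
  V j = Σ< d (λ a → HB 0 d B (j - + a))
  mirror : ∀ a → a ≤ e → reflect 0 e (i - + (e ∸ a)) ≡ (- i - + 1) - + a
  mirror a a≤e = begin
    reflect 0 e (i - + (e ∸ a))         ≡⟨ reflect₀ e (i - + (e ∸ a)) ⟩
    (- (i - + (e ∸ a)) - + 1) - + e     ≡⟨ cong (λ x → (- (i - x) - + 1) - + e) (sym (sub-≥ a≤e)) ⟩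
    (- (i - (+ e - + a)) - + 1) - + e   ≡⟨ regroup i (+ e) (+ a) ⟩
    (- i - + 1) - + a                   ∎
    where
    regroup : ∀ (I E A : ℤ) → (- (I - (E - A)) - + 1) - E ≡ (- I - + 1) - A
    regroup = solve-∀
  one-side : ∀ j → ∣ j ∣ < B → V j + V (- j - + 1) ≡ 1
  one-side (+ k) k<B = begin
    V (+ k) + V (- (+ k) - + 1) ≡⟨ cong (λ x → V (+ k) + V x) (neg-pred k) ⟩
    V (+ k) + V -[1+ k ]       ≡⟨ cong₂ _+_ (H₀-window e B k k<B) (H₀-window-neg d d B k) ⟩
    1                          ∎
  one-side -[1+ k ] k<B =
    cong₂ _+_ (H₀-window-neg d d B k) (H₀-window e B k (NP.<-trans (NP.n<1+n k) k<B))

W-rec : ∀ n e B i → W (suc n) e B i ≡ Σ< e (λ b → W n e B (i - + suc b))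
W-rec n e B i = begin
  Σ< (suc e) (λ a → K (suc n) e B (i - + a))
    ≡⟨ Σ-cong (suc e) (λ a _ → K-rec n e B (i - + a)) ⟩
  Σ< (suc e) (λ a → Σ< e (λ b → K n e B (i - + a - + suc b)))
    ≡⟨ Σ-swap (suc e) e (λ a b → K n e B (i - + a - + suc b)) ⟩
  Σ< e (λ b → Σ< (suc e) (λ a → K n e B (i - + a - + suc b)))
    ≡⟨ Σ-cong e (λ b _ → Σ-cong (suc e) (λ a _ → cong (K n e B) (sub-swap i _ _))) ⟩
  Σ< e (λ b → W n e B (i - + suc b)) ∎

W-const : ∀ n e B i → ∣ i ∣ + n * suc e < B → W n e B i ≡ e N.^ n
W-const zero    e B i bound = W₀ e B i (NP.≤-trans (s≤s (NP.m≤m+n ∣ i ∣ 0)) bound)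
W-const (suc n) e B i bound = begin
  W (suc n) e B i                      ≡⟨ W-rec n e B i ⟩
  Σ< e (λ b → W n e B (i - + suc b))   ≡⟨ Σ-cong e (λ b b<e → W-const n e B (i - + suc b) (shifted b b<e)) ⟩
  Σ< e (λ _ → e N.^ n)                 ≡⟨ Σ-const e (e N.^ n) ⟩
  e N.^ suc n                          ∎
  where
  shifted : ∀ b → b < e → ∣ i - + suc b ∣ + n * suc e < B
  shifted b b<e = NP.≤-<-trans (NP.+-monoˡ-≤ (n * suc e) |i-b|≤) (NP.≤-<-trans reassoc bound)
    where
    |i-b|≤ : ∣ i - + suc b ∣ ≤ ∣ i ∣ + suc e
    |i-b|≤ = NP.≤-trans (ZP.∣i-j∣≤∣i∣+∣j∣ i (+ suc b)) (NP.+-monoʳ-≤ ∣ i ∣ (NP.<⇒≤ (s≤s b<e)))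
    reassoc : ∣ i ∣ + suc e + n * suc e ≤ ∣ i ∣ + suc n * suc e
    reassoc = NP.≤-reflexive (NP.+-assoc ∣ i ∣ (suc e) (n * suc e))

-- Consecutive reflected pairs alternate: K_{n+1}(i) + K_n(i) = W_n(i) = e^n.
K-alternate : ∀ n e B i → ∣ i ∣ + n * suc e < B → K (suc n) e B i + K n e B i ≡ e N.^ n
K-alternate n e B i bound = begin
  K (suc n) e B i + K n e B i
    ≡⟨ cong (N._+ K n e B i) (K-rec n e B i) ⟩
  Σ< e (λ a → K n e B (i - + suc a)) + K n e B i
    ≡⟨ NP.+-comm _ (K n e B i) ⟩
  K n e B i + Σ< e (λ a → K n e B (i - + suc a))
    ≡⟨ cong (λ j → K n e B j + Σ< e (λ a → K n e B (i - + suc a))) (sym (ZP.+-identityʳ i)) ⟩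
  K n e B (i - + 0) + Σ< e (λ a → K n e B (i - + suc a))
    ≡⟨ sym (Σ-front e (λ a → K n e B (i - + a))) ⟩
  W n e B i
    ≡⟨ W-const n e B i bound ⟩
  e N.^ n ∎

pos-cancel : ∀ x y → + x ≡ + (x + y) - + y
pos-cancel x y = trans (cancel (+ x) (+ y)) (cong (_- + y) (sym (ZP.pos-+ x y)))
  where
  cancel : ∀ (X Y : ℤ) → X ≡ X +ℤ Y - Y
  cancel = solve-∀

-- If d k = P - s then d (P - k) = (d - 1) P + s: one step of the alternating sum.
alternate-step : ∀ (E P s k : ℤ) → (+ 1 +ℤ E) *ℤ k ≡ P - s →
                 (+ 1 +ℤ E) *ℤ (P - k) ≡ E *ℤ P - (- (+ 1)) *ℤ s
alternate-step E P s k dk = begin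
  (+ 1 +ℤ E) *ℤ (P - k)                   ≡⟨ distrib E P k ⟩
  (+ 1 +ℤ E) *ℤ P - (+ 1 +ℤ E) *ℤ k       ≡⟨ cong (λ x → (+ 1 +ℤ E) *ℤ P - x) dk ⟩
  (+ 1 +ℤ E) *ℤ P - (P - s)               ≡⟨ collect E P s ⟩
  E *ℤ P - (- (+ 1)) *ℤ s                 ∎
  where
  distrib : ∀ (E P k : ℤ) → (+ 1 +ℤ E) *ℤ (P - k) ≡ (+ 1 +ℤ E) *ℤ P - (+ 1 +ℤ E) *ℤ k
  distrib = solve-∀
  collect : ∀ (E P s : ℤ) → (+ 1 +ℤ E) *ℤ P - (P - s) ≡ E *ℤ P - (- (+ 1)) *ℤ s
  collect = solve-∀

K-closed : ∀ n e B i → ¬ (suc e ∣ i) → i + n * suc e < B →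
           + suc e *ℤ + K n e B (+ i) ≡ (+ e) ^ n - (- (+ 1)) ^ n
K-closed zero    e B i d∤i _     =
  trans (cong (λ x → + suc e *ℤ + x) (K₀-vanish e B i d∤i)) (ZP.*-zeroʳ (+ suc e))
K-closed (suc n) e B i d∤i bound = begin
  + suc e *ℤ + K₁
    ≡⟨ cong (+ suc e *ℤ_) (pos-cancel K₁ K₀) ⟩
  + suc e *ℤ (+ (K₁ + K₀) - + K₀)
    ≡⟨ cong (λ x → + suc e *ℤ (x - + K₀)) (trans (cong +_ (K-alternate n e B (+ i) bound′)) (pos-^ e n)) ⟩
  + suc e *ℤ ((+ e) ^ n - + K₀)
    ≡⟨ cong (_*ℤ ((+ e) ^ n - + K₀)) (ZP.pos-+ 1 e) ⟩
  (+ 1 +ℤ + e) *ℤ ((+ e) ^ n - + K₀)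
    ≡⟨ alternate-step (+ e) ((+ e) ^ n) ((- (+ 1)) ^ n) (+ K₀)
         (trans (cong (_*ℤ + K₀) (sym (ZP.pos-+ 1 e))) (K-closed n e B i d∤i bound′)) ⟩
  (+ e) ^ suc n - (- (+ 1)) ^ suc n ∎
  where
  K₁ = K (suc n) e B (+ i)
  K₀ = K n e B (+ i)
  bound′ : i + n * suc e < B
  bound′ = NP.≤-<-trans (NP.+-monoʳ-≤ i (NP.m≤n+m (n * suc e) (suc e))) bound

mainTheorem5 : (n d : ℕ) → 1 ≤ n → 1 ≤ d → (i : ℕ) → i ≤ n N.* d → ¬ (d ∣ i) →
    (+ d) *ℤ ((+ H n d (+ i)) +ℤ (+ H n d ((+ (n N.* d)) - (+ i) - (+ d))))
    ≡ (+ (d ∸ 1)) ^ n - (- (+ 1)) ^ n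
mainTheorem5 n (suc e) _ _ i _ d∤i = begin
  + d *ℤ (+ H n d (+ i) +ℤ + H n d (reflect n e (+ i)))
    ≡⟨ cong₂ (λ x y → + d *ℤ (+ x +ℤ + y))
             (H-trunc n e B (+ i) i<B) (H-trunc n e B (reflect n e (+ i)) reflected<B) ⟩
  + d *ℤ (+ HB n d B (+ i) +ℤ + HB n d B (reflect n e (+ i)))
    ≡⟨ cong (+ d *ℤ_) (sym (ZP.pos-+ (HB n d B (+ i)) (HB n d B (reflect n e (+ i))))) ⟩
  + d *ℤ + K n e B (+ i)
    ≡⟨ K-closed n e B i d∤i i+nd<B ⟩
  (+ e) ^ n - (- (+ 1)) ^ n ∎
  where
  d = suc e
  -- Any B > nd + i + d bounds every index that occurs.
  B = suc (n * d + i + d)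
  i<B : i < B
  i<B = s≤s (NP.≤-trans (NP.m≤n+m i (n * d)) (NP.m≤m+n (n * d + i) d))
  i+nd<B : i + n * d < B
  i+nd<B = s≤s (NP.≤-trans (NP.≤-reflexive (NP.+-comm i (n * d))) (NP.m≤m+n (n * d + i) d))
  reflected<B : ∣ reflect n e (+ i) ∣ < B
  reflected<B = s≤s (NP.≤-trans (ZP.∣i-j∣≤∣i∣+∣j∣ (+ (n * d) - + i) (+ d))
                                (NP.+-monoˡ-≤ d (ZP.∣i-j∣≤∣i∣+∣j∣ (+ (n * d)) (+ i))))
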